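{- Let $\Gamma$ be an abelian group written additively, $(G,\varphi)$ a $\Gamma$-gain graph on a finite graph $G$, and $T$ a maximal forest of $G$. Then there is a unique $T$-normalized $\Gamma$-gain function $\varphi_T$ on $G$ that is shifting equivalent to $\varphi$.
   Context: A $\Gamma$-gain function on $G$ assigns to each oriented edge $e$ a value $\varphi(e)\in\Gamma$ with $\varphi(-e)=-\varphi(e)$, where $-e$ is the reverse orientation. For a cycle $C$ with oriented edges $e_1,\dots,e_k$ in cyclic order in one direction and $a\in\Gamma$, $\psi_{C,a}$ is the gain function with $\psi_{C,a}(e_i)=a$ for all $i$ and $\psi_{C,a}(e)=0$ for every edge not on $C$. A shift replaces $\varphi$ by $\varphi+\psi_{C,a}$; two gain functions are shifting equivalent if one is obtained from the other by a finite sequence of shifts. A gain function is $T$-normalized if it is zero on every edge of $G$ not in $T$. -}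

module Defs where

open import Level using (Level; _⊔_)
open import Data.Nat using (ℕ; suc)
open import Data.Fin using (Fin; zero; suc; inject₁; fromℕ)
open import Data.Fin.Properties using (any?)
import Data.Fin.Properties as FinP
open import Data.Bool using (Bool; true; false; not; if_then_else_; _∨_)
import Data.Bool.Properties as BoolP
open import Data.Product using (Σ; ∃; _×_; _,_; proj₁; proj₂)
open import Data.Product.Properties using (≡-dec)
open import Relation.Nullary using (¬_; Dec)
open import Relation.Nullary.Decidable using (⌊_⌋)
open import Relation.Binary.PropositionalEquality using (_≡_)
open import Relation.Binary.Construct.Closure.ReflexiveTransitive using (Star)
open import Function.Definitions using (Injective)
open import Algebra.Bundles using (AbelianGroup)

-- A finite graph (loops and parallel edges allowed): vertices Fin nV,
-- edges Fin nE, each edge with a chosen reference orientation src → tgt.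
record Graph : Set where
  field
    nV  : ℕ
    nE  : ℕ
    src : Fin nE → Fin nV
    tgt : Fin nE → Fin nV

module _ (G : Graph) where
  open Graph G

  -- Oriented edges: (e , true) is e in its reference orientation,
  -- (e , false) is the reverse orientation -e.
  OEdge : Set
  OEdge = Fin nE × Bool

  rev : OEdge → OEdge
  rev (e , b) = e , not b

  tailO : OEdge → Fin nV
  tailO (e , true)  = src e
  tailO (e , false) = tgt e

  headO : OEdge → Fin nV
  headO (e , true)  = tgt e
  headO (e , false) = src e

  record Cycle : Set where
    field
      len      : ℕ
      edge     : Fin (suc len) → OEdge
      linked   : ∀ (i : Fin len) → headO (edge (inject₁ i)) ≡ tailO (edge (suc i))
      closed   : headO (edge (fromℕ len)) ≡ tailO (edge zero)
      edgeInj  : Injective _≡_ _≡_ (λ i → proj₁ (edge i))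
      vertInj  : Injective _≡_ _≡_ (λ i → tailO (edge i))

  _≟ₒ_ : (o o' : OEdge) → Dec (o ≡ o')
  _≟ₒ_ = ≡-dec FinP._≟_ BoolP._≟_

  occurs : Cycle → OEdge → Bool
  occurs C o = ⌊ any? (λ i → Cycle.edge C i ≟ₒ o) ⌋

  EdgeSet : Set
  EdgeSet = Fin nE → Bool

  insert : EdgeSet → Fin nE → EdgeSet
  insert T x y = T y ∨ ⌊ y FinP.≟ x ⌋

  Forest : EdgeSet → Set
  Forest T = ∀ (C : Cycle) → ¬ (∀ i → T (proj₁ (Cycle.edge C i)) ≡ true)

  MaximalForest : EdgeSet → Set
  MaximalForest T = Forest T × (∀ x → T x ≡ false → ¬ Forest (insert T x))

  module _ {c ℓ : Level} (Γ : AbelianGroup c ℓ) where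
    open AbelianGroup Γ renaming (Carrier to A; _∙_ to _+_; ε to 0#; _⁻¹ to -_)

    EFun : Set c
    EFun = OEdge → A

    IsGain : EFun → Set ℓ
    IsGain φ = ∀ o → φ (rev o) ≈ - φ o

    ψ : Cycle → A → EFun
    ψ C a o = if occurs C o then a else (if occurs C (rev o) then - a else 0#)

    Shift : EFun → EFun → Set (c ⊔ ℓ)
    Shift φ φ' = Σ Cycle λ C → Σ A λ a → ∀ o → φ' o ≈ φ o + ψ C a o

    ShiftEquiv : EFun → EFun → Set (c ⊔ ℓ)
    ShiftEquiv = Star Shift

    Normalized : EdgeSet → EFun → Set ℓ
    Normalized T φ = ∀ x b → T x ≡ false → φ (x , b) ≈ 0#

    _≈ᶠ_ : EFun → EFun → Set ℓ
    φ ≈ᶠ φ' = ∀ o → φ o ≈ φ' o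

module Submission where

-- Existence: by maximality, the ends of every edge x outside T are joined by a walk in T,
-- and shifting along the resulting fundamental cycle by - φ (x , true) clears x without
-- touching any other edge outside T.  Uniqueness: for a tree edge t let S be the set of
-- vertices reachable from src t in T - t.  The outflow of a gain function from S (its sum
-- over the oriented edges with tail in S) is invariant under shifts, since a cycle leaves S
-- as often as it enters it; for a T-normalized gain function it is the gain on t.

open import Defs
open import Level using (Level)
open import Function using (_∘_)
open import Data.Nat using (ℕ; zero; suc; _≤_; _<_; z≤n; s≤s)
import Data.Nat.Properties as ℕ
open import Data.Fin using (Fin; zero; suc; inject₁; fromℕ; toℕ; punchIn)
import Data.Fin.Properties as Fin
open import Data.Bool using (Bool; true; false; not; if_then_else_; _∨_)
import Data.Bool.Properties as Bool
open import Data.Product using (Σ; ∃; _×_; _,_; proj₁; proj₂)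
open import Data.Sum using (_⊎_; inj₁; inj₂)
open import Data.Empty using (⊥-elim)
open import Relation.Nullary using (¬_; ¬?; Dec; yes; no)
open import Relation.Nullary.Decidable
  using (⌊_⌋; map′; _⊎-dec_; _×-dec_; does-⇔; isYes≗does; dec-true; dec-false)
open import Relation.Nullary using (does)
open import Function.Bundles using (mk⇔)
import Data.Vec.Functional as Vec
open import Data.List using (List; []; _∷_; allFin)
open import Data.List.Membership.Propositional using (_∈_)
open import Data.List.Membership.Propositional.Properties using (∈-allFin)
open import Data.List.Relation.Unary.Any using (here; there)
open import Relation.Unary using (Decidable)
open import Relation.Binary.PropositionalEquality as ≡ using (_≡_; _≢_)
open import Function.Definitions using (Injective)
open import Algebra.Bundles using (AbelianGroup)
import Relation.Binary.Construct.Closure.ReflexiveTransitive as Star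

⌊⌋-true : ∀ {P : Set} (d : Dec P) → P → ⌊ d ⌋ ≡ true
⌊⌋-true d p = ≡.trans (isYes≗does d) (dec-true d p)

⌊⌋-false : ∀ {P : Set} (d : Dec P) → ¬ P → ⌊ d ⌋ ≡ false
⌊⌋-false d ¬p = ≡.trans (isYes≗does d) (dec-false d ¬p)

⌊⌋-witness : ∀ {P : Set} (d : Dec P) → ⌊ d ⌋ ≡ true → P
⌊⌋-witness (yes p) _  = p
⌊⌋-witness (no _)  ()

module Sums {c ℓ : Level} (Γ : AbelianGroup c ℓ) where
  open AbelianGroup Γ renaming (Carrier to A; _∙_ to _+_; ε to 0#; _⁻¹ to -_)
  open import Algebra.Properties.AbelianGroup Γ using (ε⁻¹≈ε; ⁻¹-∙-comm)
  open import Algebra.Properties.CommutativeMonoid.Sum commutativeMonoid public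
    using (sum; sum-cong-≋; ∑-distrib-+; ∑-comm)
  open import Algebra.Properties.CommutativeMonoid.Sum commutativeMonoid
    using (sum-replicate-zero; sum-remove; sum-init-last)
  open import Relation.Binary.Reasoning.Setoid setoid

  sum-zero : ∀ {n} {f : Fin n → A} → (∀ i → f i ≈ 0#) → sum f ≈ 0#
  sum-zero {n} f≈0 = trans (sum-cong-≋ f≈0) (sum-replicate-zero n)

  sum-⁻¹ : ∀ {n} (f : Fin n → A) → sum (λ i → - f i) ≈ - sum f
  sum-⁻¹ {zero}  f = sym ε⁻¹≈ε
  sum-⁻¹ {suc n} f = trans (∙-congˡ (sum-⁻¹ (f ∘ suc))) (⁻¹-∙-comm _ _)

  sum-single : ∀ {n} (f : Fin n → A) i → (∀ j → j ≢ i → f j ≈ 0#) → sum f ≈ f i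
  sum-single {suc n} f i off = begin
    sum f                             ≈⟨ sum-remove {i = i} f ⟩
    f i + sum (λ j → f (punchIn i j)) ≈⟨ ∙-congˡ (sum-zero (λ j → off _ (Fin.punchInᵢ≢i i j))) ⟩
    f i + 0#                          ≈⟨ identityʳ _ ⟩
    f i                               ∎

  sum-cyclic-differences : ∀ {n} (t h : Fin (suc n) → A) →
    (∀ i → h (inject₁ i) ≈ t (suc i)) → h (fromℕ n) ≈ t zero →
    sum (λ i → t i + - h i) ≈ 0#
  sum-cyclic-differences {n} t h shift wrap = begin
    sum (λ i → t i + - h i)   ≈⟨ ∑-distrib-+ t (λ i → - h i) ⟩
    sum t + sum (λ i → - h i) ≈⟨ ∙-congˡ (sum-⁻¹ h) ⟩
    sum t + - sum h           ≈⟨ ∙-congˡ (⁻¹-cong sum-h) ⟩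
    sum t + - sum t           ≈⟨ inverseʳ _ ⟩
    0#                        ∎
    where
    sum-h : sum h ≈ sum t
    sum-h = begin
      sum h                                   ≈⟨ sum-init-last h ⟩
      sum (λ i → h (inject₁ i)) + h (fromℕ n) ≈⟨ ∙-cong (sum-cong-≋ shift) wrap ⟩
      sum (λ i → t (suc i)) + t zero          ≈⟨ comm _ _ ⟩
      sum t                                   ∎

  select : Bool → A → A
  select b x = if b then x else 0#

  select-cong : ∀ b {x y} → x ≈ y → select b x ≈ select b y
  select-cong true  x≈y = x≈y
  select-cong false _   = refl

  select-zero : ∀ b {x} → x ≈ 0# → select b x ≈ 0#
  select-zero true  x≈0 = x≈0
  select-zero false _   = refl

  select-+ : ∀ b x y → select b (x + y) ≈ select b x + select b y
  select-+ true  x y = refl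
  select-+ false x y = sym (identityˡ 0#)

  select-⁻¹ : ∀ b x → select b (- x) ≈ - select b x
  select-⁻¹ true  x = refl
  select-⁻¹ false x = sym ε⁻¹≈ε

  select-yes : ∀ {P : Set} (d : Dec P) {x} → P → select ⌊ d ⌋ x ≈ x
  select-yes (yes _) _  = refl
  select-yes (no ¬p) p = ⊥-elim (¬p p)

  select-no : ∀ {P : Set} (d : Dec P) {x} → ¬ P → select ⌊ d ⌋ x ≈ 0#
  select-no (yes p) ¬p = ⊥-elim (¬p p)
  select-no (no _)  _  = refl

  select-sum : ∀ b {n} (f : Fin n → A) → select b (sum f) ≈ sum (λ i → select b (f i))
  select-sum true  f = refl
  select-sum false {n} f = sym (sum-zero {n} (λ _ → refl))

module Orientations (G : Graph) where
  open Graph G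
  open ≡ using (refl)

  rev-involutive : ∀ o → rev G (rev G o) ≡ o
  rev-involutive (e , true)  = refl
  rev-involutive (e , false) = refl

  tailO-rev : ∀ o → tailO G (rev G o) ≡ headO G o
  tailO-rev (e , true)  = refl
  tailO-rev (e , false) = refl

  headO-rev : ∀ o → headO G (rev G o) ≡ tailO G o
  headO-rev (e , true)  = refl
  headO-rev (e , false) = refl

  rev-≢ : ∀ o → rev G o ≢ o
  rev-≢ (e , true)  ()
  rev-≢ (e , false) ()

  same-edge : ∀ o o' → proj₁ o ≡ proj₁ o' → o' ≡ o ⊎ o' ≡ rev G o
  same-edge (e , true)  (.e , true)  refl = inj₁ refl
  same-edge (e , true)  (.e , false) refl = inj₂ refl
  same-edge (e , false) (.e , true)  refl = inj₂ refl
  same-edge (e , false) (.e , false) refl = inj₁ refl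

  anyOEdge? : {P : OEdge G → Set} → Decidable P → Dec (∃ P)
  anyOEdge? P? = map′
    (λ { (e , inj₁ p) → (e , true) , p ; (e , inj₂ p) → (e , false) , p })
    (λ { ((e , true) , p) → e , inj₁ p ; ((e , false) , p) → e , inj₂ p })
    (Fin.any? (λ e → P? (e , true) ⊎-dec P? (e , false)))

module Walks (G : Graph) (X : Fin (Graph.nE G) → Set) where
  open Graph G
  open Orientations G
  open ≡ using (refl; sym; trans; cong)

  private
    variable
      u v w : Fin nV

  infixr 5 _∷⟨_⟩_
  data Walk : Fin nV → Fin nV → Set where
    []     : Walk v v
    _∷⟨_⟩_ : (o : OEdge G) → X (proj₁ o) → Walk (headO G o) w → Walk (tailO G o) w

  length : Walk u w → ℕ
  length []            = zero
  length (_ ∷⟨ _ ⟩ p) = suc (length p)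

  vertexAt : (p : Walk u w) → Fin (suc (length p)) → Fin nV
  vertexAt {u} []         zero    = u
  vertexAt (o ∷⟨ _ ⟩ _) zero    = tailO G o
  vertexAt (_ ∷⟨ _ ⟩ p) (suc i) = vertexAt p i

  edgeAt : (p : Walk u w) → Fin (length p) → OEdge G
  edgeAt (o ∷⟨ _ ⟩ _) zero    = o
  edgeAt (_ ∷⟨ _ ⟩ p) (suc i) = edgeAt p i

  edgeAt-∈ : (p : Walk u w) (i : Fin (length p)) → X (proj₁ (edgeAt p i))
  edgeAt-∈ (_ ∷⟨ x ⟩ _) zero    = x
  edgeAt-∈ (_ ∷⟨ _ ⟩ p) (suc i) = edgeAt-∈ p i

  vertexAt-zero : (p : Walk u w) → vertexAt p zero ≡ u
  vertexAt-zero []             = refl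
  vertexAt-zero (_ ∷⟨ _ ⟩ _) = refl

  vertexAt-last : (p : Walk u w) → vertexAt p (fromℕ (length p)) ≡ w
  vertexAt-last []             = refl
  vertexAt-last (_ ∷⟨ _ ⟩ p) = vertexAt-last p

  tailO-edgeAt : (p : Walk u w) (i : Fin (length p)) → tailO G (edgeAt p i) ≡ vertexAt p (inject₁ i)
  tailO-edgeAt (_ ∷⟨ _ ⟩ _) zero    = refl
  tailO-edgeAt (_ ∷⟨ _ ⟩ p) (suc i) = tailO-edgeAt p i

  headO-edgeAt : (p : Walk u w) (i : Fin (length p)) → headO G (edgeAt p i) ≡ vertexAt p (suc i)
  headO-edgeAt (_ ∷⟨ _ ⟩ p) zero    = sym (vertexAt-zero p)
  headO-edgeAt (_ ∷⟨ _ ⟩ p) (suc i) = headO-edgeAt p i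

  infixr 5 _++_
  _++_ : Walk u v → Walk v w → Walk u w
  []             ++ q = q
  (o ∷⟨ x ⟩ p) ++ q = o ∷⟨ x ⟩ (p ++ q)

  Simple : Walk u w → Set
  Simple p = Injective _≡_ _≡_ (vertexAt p)

  simple-length : {p : Walk u w} → Simple p → length p < nV
  simple-length = Fin.injective⇒≤

  simple-∷ : {o : OEdge G} {x : X (proj₁ o)} {p : Walk (headO G o) w} →
             ¬ (∃ λ j → vertexAt p j ≡ tailO G o) → Simple p → Simple (o ∷⟨ x ⟩ p)
  simple-∷ fresh s {zero}  {zero}  _  = refl
  simple-∷ fresh s {zero}  {suc j} eq = ⊥-elim (fresh (j , sym eq))
  simple-∷ fresh s {suc i} {zero}  eq = ⊥-elim (fresh (i , eq))
  simple-∷ fresh s {suc i} {suc j} eq = cong suc (s eq)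

  suffix : (p : Walk u w) (j : Fin (suc (length p))) → vertexAt p j ≡ v → Walk v w
  suffix []             zero    refl = []
  suffix (o ∷⟨ x ⟩ p) zero    refl = o ∷⟨ x ⟩ p
  suffix (_ ∷⟨ _ ⟩ p) (suc j) eq   = suffix p j eq

  suffix-simple : (p : Walk u w) (j : Fin (suc (length p))) (eq : vertexAt p j ≡ v) →
                  Simple p → Simple (suffix p j eq)
  suffix-simple []             zero    refl s = s
  suffix-simple (_ ∷⟨ _ ⟩ _) zero    refl s = s
  suffix-simple (_ ∷⟨ _ ⟩ p) (suc j) eq   s = suffix-simple p j eq (Fin.suc-injective ∘ s)

  simplify : Walk u w → Σ (Walk u w) Simple
  simplify []             = [] , λ { {zero} {zero} _ → refl }
  simplify (o ∷⟨ x ⟩ p) with simplify p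
  ... | q , q-simple with Fin.any? (λ j → vertexAt q j Fin.≟ tailO G o)
  ...   | yes (j , eq) = suffix q j eq , suffix-simple q j eq q-simple
  ...   | no fresh     = o ∷⟨ x ⟩ q , simple-∷ fresh q-simple

  simple-edges-distinct : {p : Walk u w} → Simple p → Injective _≡_ _≡_ (λ i → proj₁ (edgeAt p i))
  simple-edges-distinct {p = p} s {i} {j} eq with same-edge (edgeAt p i) (edgeAt p j) eq
  ... | inj₁ same     = Fin.inject₁-injective (s (begin
    vertexAt p (inject₁ i) ≡⟨ sym (tailO-edgeAt p i) ⟩
    tailO G (edgeAt p i)   ≡⟨ cong (tailO G) (sym same) ⟩
    tailO G (edgeAt p j)   ≡⟨ tailO-edgeAt p j ⟩
    vertexAt p (inject₁ j) ∎))
    where open ≡.≡-Reasoning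
  ... | inj₂ opposite = ⊥-elim (ℕ.<-asym (before j i j+1≡i) (before i j i+1≡j))
    where
    before : ∀ k l → suc k ≡ inject₁ l → toℕ k < toℕ l
    before k l eq = ℕ.≤-reflexive (trans (cong toℕ eq) (Fin.toℕ-inject₁ l))
    j+1≡i : suc j ≡ inject₁ i
    j+1≡i = s (trans (sym (headO-edgeAt p j))
               (trans (cong (headO G) opposite) (trans (headO-rev (edgeAt p i)) (tailO-edgeAt p i))))
    i+1≡j : suc i ≡ inject₁ j
    i+1≡j = s (trans (sym (headO-edgeAt p i))
               (trans (sym (tailO-rev (edgeAt p i))) (trans (cong (tailO G) (sym opposite)) (tailO-edgeAt p j))))

  rotate : ∀ {n} → Fin (suc n) → Fin (suc n)
  rotate zero    = fromℕ _
  rotate (suc i) = inject₁ i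

  rotate-injective : ∀ {n} → Injective _≡_ _≡_ (rotate {n})
  rotate-injective {_} {zero}  {zero}  _  = refl
  rotate-injective {_} {zero}  {suc j} eq = ⊥-elim (Fin.fromℕ≢inject₁ eq)
  rotate-injective {_} {suc i} {zero}  eq = ⊥-elim (Fin.fromℕ≢inject₁ (sym eq))
  rotate-injective {_} {suc i} {suc j} eq = cong suc (Fin.inject₁-injective eq)

  closeCycle : (o : OEdge G) (p : Walk (headO G o) (tailO G o)) → Simple p →
               (∀ i → proj₁ (edgeAt p i) ≢ proj₁ o) → Cycle G
  closeCycle o p s avoids-o = record
    { len     = length p
    ; edge    = edge
    ; linked  = λ i → trans (headO-edge (inject₁ i)) (sym (tailO-edgeAt p i))
    ; closed  = trans (headO-edge (fromℕ (length p))) (vertexAt-last p)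
    ; edgeInj = edgeInj
    ; vertInj = λ {k} {l} eq →
        rotate-injective (s (trans (sym (tailO-edge k)) (trans eq (tailO-edge l))))
    }
    where
    edge : Fin (suc (length p)) → OEdge G
    edge = o Vec.∷ edgeAt p
    headO-edge : ∀ k → headO G (edge k) ≡ vertexAt p k
    headO-edge zero    = sym (vertexAt-zero p)
    headO-edge (suc i) = headO-edgeAt p i
    tailO-edge : ∀ k → tailO G (edge k) ≡ vertexAt p (rotate k)
    tailO-edge zero    = sym (vertexAt-last p)
    tailO-edge (suc i) = tailO-edgeAt p i
    edgeInj : Injective _≡_ _≡_ (λ k → proj₁ (edge k))
    edgeInj {zero}  {zero}  _  = refl
    edgeInj {zero}  {suc j} eq = ⊥-elim (avoids-o j (sym eq))
    edgeInj {suc i} {zero}  eq = ⊥-elim (avoids-o i eq)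
    edgeInj {suc i} {suc j} eq = cong suc (simple-edges-distinct s eq)

  BoundedWalk : ℕ → Fin nV → Fin nV → Set
  BoundedWalk k u w = Σ (Walk u w) λ p → length p ≤ k

  FirstStep : ℕ → Fin nV → Fin nV → Set
  FirstStep k u w = ∃ λ o → tailO G o ≡ u × X (proj₁ o) × BoundedWalk k (headO G o) w

  module _ (X? : Decidable X) where

    boundedWalk? : ∀ k u w → Dec (BoundedWalk k u w)
    boundedWalk? zero    u w = map′ (λ { refl → [] , z≤n }) (λ { ([] , _) → refl }) (u Fin.≟ w)
    boundedWalk? (suc k) u w = map′ extend split (u Fin.≟ w ⊎-dec anyOEdge? firstStep?)
      where
      firstStep? : ∀ o → Dec (tailO G o ≡ u × X (proj₁ o) × BoundedWalk k (headO G o) w)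
      firstStep? o = tailO G o Fin.≟ u ×-dec X? (proj₁ o) ×-dec boundedWalk? k (headO G o) w
      extend : u ≡ w ⊎ FirstStep k u w → BoundedWalk (suc k) u w
      extend (inj₁ refl)                     = [] , z≤n
      extend (inj₂ (o , refl , x , p , p≤k)) = o ∷⟨ x ⟩ p , s≤s p≤k
      split : BoundedWalk (suc k) u w → u ≡ w ⊎ FirstStep k u w
      split ([] , _)                 = inj₁ refl
      split (o ∷⟨ x ⟩ p , s≤s p≤k) = inj₂ (o , refl , x , p , p≤k)

    walk? : ∀ u w → Dec (Walk u w)
    walk? u w = map′ proj₁ shorten (boundedWalk? nV u w)
      where
      shorten : Walk u w → BoundedWalk nV u w
      shorten p with simplify p
      ... | q , q-simple = q , ℕ.<⇒≤ (simple-length q-simple)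

    walk?-along : ∀ u o → X (proj₁ o) → does (walk? u (tailO G o)) ≡ does (walk? u (headO G o))
    walk?-along u (e , true)  x =
      does-⇔ (mk⇔ (_++ ((e , true) ∷⟨ x ⟩ [])) (_++ ((e , false) ∷⟨ x ⟩ [])))
             (walk? u (src e)) (walk? u (tgt e))
    walk?-along u (e , false) x = sym (walk?-along u (e , true) x)

module Occurrences (G : Graph) (C : Cycle G) where
  open Graph G
  open Cycle C
  open Orientations G
  open ≡ using (refl; sym; trans; cong)

  occurs? : (o : OEdge G) → Dec (∃ λ i → edge i ≡ o)
  occurs? o = Fin.any? (λ i → _≟ₒ_ G (edge i) o)

  occurs-edge : ∀ i → occurs G C (edge i) ≡ true
  occurs-edge i = ⌊⌋-true (occurs? _) (i , refl)

  occurs-absent : ∀ y b → (∀ i → proj₁ (edge i) ≢ y) → occurs G C (y , b) ≡ false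
  occurs-absent y b absent = ⌊⌋-false (occurs? _) (λ (i , eq) → absent i (cong proj₁ eq))

  occurs-not-both : ∀ o → occurs G C o ≡ true → occurs G C (rev G o) ≡ false
  occurs-not-both o occ = ⌊⌋-false (occurs? _) rev-absent
    where
    rev-absent : ¬ ∃ (λ j → edge j ≡ rev G o)
    rev-absent (j , eⱼ≡rev) with ⌊⌋-witness (occurs? o) occ
    ... | i , eᵢ≡o = rev-≢ o (trans (sym eⱼ≡rev) (trans (cong edge j≡i) eᵢ≡o))
      where
      j≡i : j ≡ i
      j≡i = edgeInj (trans (cong proj₁ eⱼ≡rev) (sym (cong proj₁ eᵢ≡o)))

module Gains {c ℓ : Level} (Γ : AbelianGroup c ℓ) (G : Graph) where
  open Graph G
  open AbelianGroup Γ renaming (Carrier to A; _∙_ to _+_; ε to 0#; _⁻¹ to -_)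
  open import Algebra.Properties.AbelianGroup Γ
    using (ε⁻¹≈ε; ⁻¹-involutive; ⁻¹-∙-comm; x∙y⁻¹≈ε⇒x≈y)
  open import Algebra.Properties.CommutativeSemigroup commutativeSemigroup using (interchange)
  open import Relation.Binary.Reasoning.Setoid setoid
  open Sums Γ
  open Orientations G

  +-isGain : ∀ {φ φ'} → IsGain G Γ φ → IsGain G Γ φ' → IsGain G Γ (λ o → φ o + φ' o)
  +-isGain g g' o = trans (∙-cong (g o) (g' o)) (⁻¹-∙-comm _ _)

  gain-balanced : ∀ {φ} → IsGain G Γ φ → ∀ e → φ (e , true) + φ (e , false) ≈ 0#
  gain-balanced g e = trans (∙-congˡ (g (e , true))) (inverseʳ _)

  outflowAt : (Fin nV → Bool) → EFun G Γ → Fin nE → A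
  outflowAt S φ e = select (S (src e)) (φ (e , true)) + select (S (tgt e)) (φ (e , false))

  outflow : (Fin nV → Bool) → EFun G Γ → A
  outflow S φ = sum (outflowAt S φ)

  outflow-cong : ∀ S {φ φ'} → _≈ᶠ_ G Γ φ φ' → outflow S φ ≈ outflow S φ'
  outflow-cong S {φ} {φ'} φ≈φ' =
    sum-cong-≋ {x = outflowAt S φ} {y = outflowAt S φ'}
      (λ e → ∙-cong (select-cong _ (φ≈φ' _)) (select-cong _ (φ≈φ' _)))

  outflow-+ : ∀ S φ φ' → outflow S (λ o → φ o + φ' o) ≈ outflow S φ + outflow S φ'
  outflow-+ S φ φ' = begin
    outflow S (λ o → φ o + φ' o)
      ≈⟨ sum-cong-≋ {x = outflowAt S (λ o → φ o + φ' o)} split ⟩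
    sum (λ e → outflowAt S φ e + outflowAt S φ' e)
      ≈⟨ ∑-distrib-+ (outflowAt S φ) (outflowAt S φ') ⟩
    outflow S φ + outflow S φ'                      ∎
    where
    split : ∀ e → outflowAt S (λ o → φ o + φ' o) e ≈ outflowAt S φ e + outflowAt S φ' e
    split e = trans (∙-cong (select-+ (S (src e)) (φ (e , true)) (φ' (e , true)))
                            (select-+ (S (tgt e)) (φ (e , false)) (φ' (e , false))))
                    (interchange _ _ _ _)

  outflow-sum : ∀ S {n} (φ : Fin n → EFun G Γ) →
                outflow S (λ o → sum (λ i → φ i o)) ≈ sum (λ i → outflow S (φ i))
  outflow-sum S {n} φ = begin
    outflow S (λ o → sum (λ i → φ i o))
      ≈⟨ sum-cong-≋ {x = outflowAt S (λ o → sum (λ i → φ i o))} split ⟩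
    sum (λ e → sum (λ i → outflowAt S (φ i) e)) ≈⟨ ∑-comm (λ e i → outflowAt S (φ i) e) ⟩
    sum (λ i → outflow S (φ i))                   ∎
    where
    split : ∀ e → outflowAt S (λ o → sum (λ i → φ i o)) e ≈ sum (λ i → outflowAt S (φ i) e)
    split e = trans (∙-cong (select-sum (S (src e)) (λ i → φ i (e , true)))
                            (select-sum (S (tgt e)) (λ i → φ i (e , false))))
                    (sym (∑-distrib-+ (λ i → select (S (src e)) (φ i (e , true)))
                                      (λ i → select (S (tgt e)) (φ i (e , false)))))

  dipole : OEdge G → A → EFun G Γ
  dipole p a o = select ⌊ _≟ₒ_ G p o ⌋ a + select ⌊ _≟ₒ_ G p (rev G o) ⌋ (- a)

  dipole-at : ∀ p a → dipole p a p ≈ a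
  dipole-at p a = trans (∙-cong (select-yes (_≟ₒ_ G p p) ≡.refl)
                                (select-no (_≟ₒ_ G p (rev G p)) (rev-≢ p ∘ ≡.sym)))
                        (identityʳ a)

  dipole-at-rev : ∀ p a → dipole p a (rev G p) ≈ - a
  dipole-at-rev p a = trans (∙-cong (select-no (_≟ₒ_ G p (rev G p)) (rev-≢ p ∘ ≡.sym))
                                    (select-yes (_≟ₒ_ G p (rev G (rev G p))) (≡.sym (rev-involutive p))))
                            (identityˡ (- a))

  dipole-off : ∀ p a o → proj₁ o ≢ proj₁ p → dipole p a o ≈ 0#
  dipole-off p a o ne = trans (∙-cong (select-no (_≟ₒ_ G p o) (ne ∘ ≡.cong proj₁ ∘ ≡.sym))
                                      (select-no (_≟ₒ_ G p (rev G o)) (ne ∘ ≡.cong proj₁ ∘ ≡.sym)))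
                              (identityˡ 0#)

  outflow-dipole : ∀ S p a → outflow S (dipole p a) ≈ select (S (tailO G p)) a + - select (S (headO G p)) a
  outflow-dipole S p@(e , b) a = trans (sum-single _ e off-p) (at-p b)
    where
    off-p : ∀ e' → e' ≢ e → outflowAt S (dipole p a) e' ≈ 0#
    off-p e' ne = trans (∙-cong (select-zero _ (dipole-off p a _ ne)) (select-zero _ (dipole-off p a _ ne)))
                        (identityˡ 0#)
    at-p : ∀ b → outflowAt S (dipole (e , b) a) e ≈
                 select (S (tailO G (e , b))) a + - select (S (headO G (e , b))) a
    at-p true  = ∙-cong (select-cong _ (dipole-at (e , true) a))
                        (trans (select-cong _ (dipole-at-rev (e , true) a)) (select-⁻¹ _ a))
    at-p false = trans (∙-cong (trans (select-cong _ (dipole-at-rev (e , false) a)) (select-⁻¹ _ a))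
                               (select-cong _ (dipole-at (e , false) a)))
                       (comm _ _)

  module OnCycle (C : Cycle G) where
    open Cycle C
    open Occurrences G C

    private
      if-true : ∀ {b} {x y : A} → b ≡ true → (if b then x else y) ≡ x
      if-true ≡.refl = ≡.refl

      if-false : ∀ {b} {x y : A} → b ≡ false → (if b then x else y) ≡ y
      if-false ≡.refl = ≡.refl

      ψ-shape-rev : ∀ p q a → (p ≡ true → q ≡ false) →
        (if q then a else (if p then - a else 0#)) ≈ - (if p then a else (if q then - a else 0#))
      ψ-shape-rev true  true  a exclusive with () ← exclusive ≡.refl
      ψ-shape-rev true  false a _ = refl
      ψ-shape-rev false true  a _ = sym (⁻¹-involutive a)
      ψ-shape-rev false false a _ = sym ε⁻¹≈ε

      ψ-shape-select : ∀ p q a → (p ≡ true → q ≡ false) →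
        (if p then a else (if q then - a else 0#)) ≈ select p a + select q (- a)
      ψ-shape-select true  true  a exclusive with () ← exclusive ≡.refl
      ψ-shape-select true  false a _ = sym (identityʳ a)
      ψ-shape-select false q     a _ = sym (identityˡ _)

    ψ-isGain : ∀ a → IsGain G Γ (ψ G Γ C a)
    ψ-isGain a (e , true)  =
      ψ-shape-rev (occurs G C (e , true)) (occurs G C (e , false)) a (occurs-not-both (e , true))
    ψ-isGain a (e , false) =
      ψ-shape-rev (occurs G C (e , false)) (occurs G C (e , true)) a (occurs-not-both (e , false))

    ψ-selects : ∀ a o → ψ G Γ C a o ≈ select (occurs G C o) a + select (occurs G C (rev G o)) (- a)
    ψ-selects a o = ψ-shape-select (occurs G C o) (occurs G C (rev G o)) a (occurs-not-both o)

    ψ-edge : ∀ a i → ψ G Γ C a (edge i) ≈ a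
    ψ-edge a i = reflexive (if-true (occurs-edge i))

    ψ-absent : ∀ a y b → (∀ i → proj₁ (edge i) ≢ y) → ψ G Γ C a (y , b) ≈ 0#
    ψ-absent a y b absent =
      reflexive (≡.trans (if-false (occurs-absent y b absent)) (if-false (occurs-absent y (not b) absent)))

    sum-occurrences : ∀ o x → sum (λ i → select ⌊ _≟ₒ_ G (edge i) o ⌋ x) ≈ select (occurs G C o) x
    sum-occurrences o x = by-cases (occurs? o)
      where
      by-cases : (d : Dec (∃ λ i → edge i ≡ o)) →
                 sum (λ i → select ⌊ _≟ₒ_ G (edge i) o ⌋ x) ≈ select ⌊ d ⌋ x
      by-cases (yes (i , eᵢ≡o)) =
        trans (sum-single _ i (λ j j≢i → select-no (_≟ₒ_ G (edge j) o)
                                 (λ eⱼ≡o → j≢i (edgeInj (≡.cong proj₁ (≡.trans eⱼ≡o (≡.sym eᵢ≡o)))))))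
              (select-yes (_≟ₒ_ G (edge i) o) eᵢ≡o)
      by-cases (no absent) = sum-zero (λ i → select-no (_≟ₒ_ G (edge i) o) {x} (λ eq → absent (i , eq)))

    ψ-dipoles : ∀ a o → ψ G Γ C a o ≈ sum (λ i → dipole (edge i) a o)
    ψ-dipoles a o = begin
      ψ G Γ C a o                                                    ≈⟨ ψ-selects a o ⟩
      select (occurs G C o) a + select (occurs G C (rev G o)) (- a)
        ≈⟨ ∙-cong (sum-occurrences o a) (sum-occurrences (rev G o) (- a)) ⟨
      sum forward + sum backward
        ≈⟨ ∑-distrib-+ forward backward ⟨
      sum (λ i → dipole (edge i) a o)                                ∎
      where
      forward backward : Fin (suc len) → A
      forward  i = select ⌊ _≟ₒ_ G (edge i) o ⌋ a
      backward i = select ⌊ _≟ₒ_ G (edge i) (rev G o) ⌋ (- a)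

    cycle-telescope : (f : Fin nV → A) → sum (λ i → f (tailO G (edge i)) + - f (headO G (edge i))) ≈ 0#
    cycle-telescope f = sum-cyclic-differences (λ i → f (tailO G (edge i))) (λ i → f (headO G (edge i)))
      (λ i → reflexive (≡.cong f (linked i))) (reflexive (≡.cong f closed))

    constant-along-cycle : (f : Fin nV → A) (i : Fin (suc len)) →
      (∀ j → j ≢ i → f (tailO G (edge j)) ≈ f (headO G (edge j))) →
      f (tailO G (edge i)) ≈ f (headO G (edge i))
    constant-along-cycle f i constant = x∙y⁻¹≈ε⇒x≈y _ _ (begin
      f (tailO G (edge i)) + - f (headO G (edge i))
        ≈⟨ sum-single (λ j → f (tailO G (edge j)) + - f (headO G (edge j))) i
             (λ j j≢i → trans (∙-congʳ (constant j j≢i)) (inverseʳ _)) ⟨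
      sum (λ j → f (tailO G (edge j)) + - f (headO G (edge j)))
        ≈⟨ cycle-telescope f ⟩
      0# ∎)

    -- Each dipole contributes (tail in S) - (head in S), which telescopes around C.
    outflow-ψ : ∀ S a → outflow S (ψ G Γ C a) ≈ 0#
    outflow-ψ S a = begin
      outflow S (ψ G Γ C a)                                 ≈⟨ outflow-cong S (ψ-dipoles a) ⟩
      outflow S (λ o → sum (λ i → dipole (edge i) a o))    ≈⟨ outflow-sum S (λ i → dipole (edge i) a) ⟩
      sum (λ i → outflow S (dipole (edge i) a))
        ≈⟨ sum-cong-≋ {x = λ i → outflow S (dipole (edge i) a)} (λ i → outflow-dipole S (edge i) a) ⟩
      sum (λ i → select (S (tailO G (edge i))) a + - select (S (headO G (edge i))) a)
                                                            ≈⟨ cycle-telescope (λ v → select (S v) a) ⟩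
      0#                                                    ∎

  open OnCycle public using (ψ-isGain; ψ-edge; ψ-absent; constant-along-cycle)

  outflow-shift : ∀ S {φ φ'} → Shift G Γ φ φ' → outflow S φ' ≈ outflow S φ
  outflow-shift S {φ} {φ'} (C , a , φ'≈φ+ψ) = begin
    outflow S φ'                          ≈⟨ outflow-cong S φ'≈φ+ψ ⟩
    outflow S (λ o → φ o + ψ G Γ C a o)  ≈⟨ outflow-+ S φ (ψ G Γ C a) ⟩
    outflow S φ + outflow S (ψ G Γ C a)  ≈⟨ ∙-congˡ (OnCycle.outflow-ψ C S a) ⟩
    outflow S φ + 0#                      ≈⟨ identityʳ _ ⟩
    outflow S φ                           ∎

  outflow-shifts : ∀ S {φ φ'} → ShiftEquiv G Γ φ φ' → outflow S φ' ≈ outflow S φ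
  outflow-shifts S Star.ε          = refl
  outflow-shifts S (step Star.◅ steps) = trans (outflow-shifts S steps) (outflow-shift S step)

  -- Every edge other than t joining S to its complement lies outside T, where φ vanishes.
  outflow-normalized : (T : EdgeSet G) (t : Fin nE) (S : Fin nV → Bool) →
    S (src t) ≡ true → S (tgt t) ≡ false → (∀ e → T e ≡ true → e ≢ t → S (src e) ≡ S (tgt e)) →
    ∀ {φ} → IsGain G Γ φ → Normalized G Γ T φ → outflow S φ ≈ φ (t , true)
  outflow-normalized T t S src∈S tgt∉S inside {φ} g normalized =
    trans (sum-single (outflowAt S φ) t off-t) at-t
    where
    off-t : ∀ e → e ≢ t → outflowAt S φ e ≈ 0#
    off-t e e≢t with T e in e∈?T
    ... | false = trans (∙-cong (select-zero _ (normalized e true e∈?T))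
                                (select-zero _ (normalized e false e∈?T)))
                        (identityˡ 0#)
    ... | true  = begin
      select (S (src e)) (φ (e , true)) + select (S (tgt e)) (φ (e , false))
        ≈⟨ ∙-congˡ (reflexive (≡.cong (λ b → select b (φ (e , false))) (inside e e∈?T e≢t))) ⟨
      select (S (src e)) (φ (e , true)) + select (S (src e)) (φ (e , false))
        ≈⟨ select-+ (S (src e)) _ _ ⟨
      select (S (src e)) (φ (e , true) + φ (e , false))
        ≈⟨ select-zero (S (src e)) (gain-balanced g e) ⟩
      0# ∎
    at-t : outflowAt S φ t ≈ φ (t , true)
    at-t rewrite src∈S | tgt∉S = identityʳ _

module Forests (G : Graph) (T : EdgeSet G) where
  open Graph G
  open ≡ using (refl; sym; trans; cong)
  open import Data.Integer using (ℤ; +_)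
  open import Data.Integer.Properties using (+-0-abelianGroup)
  open Walks G (λ e → T e ≡ true)

  private
    T? : Decidable (λ e → T e ≡ true)
    T? e = T e Bool.≟ true

    insert-other : ∀ {x y} → insert G T x y ≡ true → y ≢ x → T y ≡ true
    insert-other {x} {y} y∈T+x y≢x = begin
      T y                  ≡⟨ Bool.∨-identityʳ (T y) ⟨
      T y ∨ false          ≡⟨ cong (T y ∨_) (⌊⌋-false (y Fin.≟ x) y≢x) ⟨
      T y ∨ ⌊ y Fin.≟ x ⌋ ≡⟨ y∈T+x ⟩
      true                 ∎
      where open ≡.≡-Reasoning

    indicator : Bool → ℤ
    indicator b = if b then + 1 else + 0

    indicator-injective : ∀ {b b'} → indicator b ≡ indicator b' → b ≡ b'
    indicator-injective {true}  {true}  _ = refl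
    indicator-injective {false} {false} _ = refl

  -- Reachability from tgt x is constant along every edge of a cycle in T + x other than x,
  -- so by telescoping its indicator in ℤ it is constant along x as well; but without a walk
  -- it separates the ends of x.
  forest-insert : Forest G T → ∀ x → ¬ Walk (tgt x) (src x) → Forest G (insert G T x)
  forest-insert forest x no-walk C in-T+x with Fin.any? (λ i → proj₁ (Cycle.edge C i) Fin.≟ x)
  ... | no x∉C = forest C (λ i → insert-other (in-T+x i) (λ eq → x∉C (i , eq)))
  ... | yes (i₀ , eᵢ₀≡x) = separates (edge i₀) eᵢ₀≡x
        (indicator-injective
          (Gains.constant-along-cycle +-0-abelianGroup G C (indicator ∘ reached) i₀ same-side))
    where
    open Cycle C
    reached : Fin nV → Bool
    reached v = does (walk? T? (tgt x) v)
    same-side : ∀ j → j ≢ i₀ →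
                indicator (reached (tailO G (edge j))) ≡ indicator (reached (headO G (edge j)))
    same-side j j≢i₀ = cong indicator (walk?-along T? (tgt x) (edge j)
      (insert-other (in-T+x j) (λ eⱼ≡x → j≢i₀ (edgeInj (trans eⱼ≡x (sym eᵢ₀≡x))))))
    tgt-reached : reached (tgt x) ≡ true
    tgt-reached = dec-true (walk? T? (tgt x) (tgt x)) []
    src-unreached : reached (src x) ≡ false
    src-unreached = dec-false (walk? T? (tgt x) (src x)) no-walk
    separates : ∀ o → proj₁ o ≡ x → reached (tailO G o) ≢ reached (headO G o)
    separates (_ , true)  refl eq with () ← trans (sym src-unreached) (trans eq tgt-reached)
    separates (_ , false) refl eq with () ← trans (sym src-unreached) (trans (sym eq) tgt-reached)

  fundamental-walk : MaximalForest G T → ∀ x → T x ≡ false → Σ (Walk (tgt x) (src x)) Simple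
  fundamental-walk (forest , maximal) x x∉T with walk? T? (tgt x) (src x)
  ... | yes p      = simplify p
  ... | no no-walk = ⊥-elim (maximal x x∉T (forest-insert forest x no-walk))

  member-≢ : ∀ {x y} → T x ≡ false → T y ≡ true → y ≢ x
  member-≢ x∉T y∈T refl with () ← trans (sym x∉T) y∈T

  fundamental-cycle : MaximalForest G T → ∀ x → T x ≡ false → Cycle G
  fundamental-cycle maximal x x∉T with fundamental-walk maximal x x∉T
  ... | p , p-simple = closeCycle (x , true) p p-simple (λ i → member-≢ x∉T (edgeAt-∈ p i))

  fundamental-cycle-in-T : (maximal : MaximalForest G T) → ∀ x (x∉T : T x ≡ false) → ∀ i →
    T (proj₁ (Cycle.edge (fundamental-cycle maximal x x∉T) (suc i))) ≡ true
  fundamental-cycle-in-T maximal x x∉T i with fundamental-walk maximal x x∉T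
  ... | p , _ = edgeAt-∈ p i

module Bypasses (G : Graph) (T : EdgeSet G) (t : Fin (Graph.nE G)) where
  open Graph G
  open Walks G (λ e → T e ≡ true × e ≢ t) public

  T-t? : Decidable (λ e → T e ≡ true × e ≢ t)
  T-t? e = T e Bool.≟ true ×-dec ¬? (e Fin.≟ t)

  no-bypass : Forest G T → T t ≡ true → ¬ Walk (src t) (tgt t)
  no-bypass forest t∈T p with simplify p
  ... | q , q-simple = forest (closeCycle (t , false) q q-simple (λ i → proj₂ (edgeAt-∈ q i)))
                              (λ { zero → t∈T ; (suc i) → proj₁ (edgeAt-∈ q i) })

module Normalization {c ℓ : Level} (Γ : AbelianGroup c ℓ) (G : Graph) (T : EdgeSet G) where
  open Graph G
  open AbelianGroup Γ renaming (Carrier to A; _∙_ to _+_; ε to 0#; _⁻¹ to -_)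
  open import Algebra.Properties.AbelianGroup Γ using (ε⁻¹≈ε)
  open import Relation.Binary.Reasoning.Setoid setoid
  open Gains Γ G

  normalized-unique : Forest G T → ∀ {φ φ₁ φ₂} → IsGain G Γ φ₁ → IsGain G Γ φ₂ →
    Normalized G Γ T φ₁ → Normalized G Γ T φ₂ → ShiftEquiv G Γ φ φ₁ → ShiftEquiv G Γ φ φ₂ →
    _≈ᶠ_ G Γ φ₁ φ₂
  normalized-unique forest {φ} {φ₁} {φ₂} g₁ g₂ n₁ n₂ s₁ s₂ (t , b) with T t in t∈?T
  ... | false = trans (n₁ t b t∈?T) (sym (n₂ t b t∈?T))
  ... | true  = on-t b
    where
    open Bypasses G T t
    S : Fin nV → Bool
    S v = does (walk? T-t? (src t) v)
    src∈S : S (src t) ≡ true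
    src∈S = dec-true (walk? T-t? (src t) (src t)) []
    tgt∉S : S (tgt t) ≡ false
    tgt∉S = dec-false (walk? T-t? (src t) (tgt t)) (no-bypass forest t∈?T)
    inside : ∀ e → T e ≡ true → e ≢ t → S (src e) ≡ S (tgt e)
    inside e e∈T e≢t = walk?-along T-t? (src t) (e , true) (e∈T , e≢t)
    on-t⁺ : φ₁ (t , true) ≈ φ₂ (t , true)
    on-t⁺ = begin
      φ₁ (t , true) ≈⟨ outflow-normalized T t S src∈S tgt∉S inside g₁ n₁ ⟨
      outflow S φ₁  ≈⟨ outflow-shifts S s₁ ⟩
      outflow S φ   ≈⟨ outflow-shifts S s₂ ⟨
      outflow S φ₂  ≈⟨ outflow-normalized T t S src∈S tgt∉S inside g₂ n₂ ⟩
      φ₂ (t , true) ∎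
    on-t : ∀ b → φ₁ (t , b) ≈ φ₂ (t , b)
    on-t true  = on-t⁺
    on-t false = trans (g₁ (t , true)) (trans (⁻¹-cong on-t⁺) (sym (g₂ (t , true))))

  clear-edge : MaximalForest G T → ∀ x → T x ≡ false → ∀ {φ} → IsGain G Γ φ →
    Σ (EFun G Γ) λ φ' → IsGain G Γ φ' × ShiftEquiv G Γ φ φ' × (∀ b → φ' (x , b) ≈ 0#) ×
      (∀ y b → T y ≡ false → y ≢ x → φ' (y , b) ≈ φ (y , b))
  clear-edge maximal x x∉T {φ} g =
    φ' , +-isGain g (ψ-isGain C a) , (C , a , λ _ → refl) Star.◅ Star.ε , cleared , unchanged
    where
    open Forests G T using (fundamental-cycle; fundamental-cycle-in-T; member-≢)
    C : Cycle G
    C = fundamental-cycle maximal x x∉T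
    a : A
    a = - φ (x , true)
    φ' : EFun G Γ
    φ' o = φ o + ψ G Γ C a o
    cleared⁺ : φ' (x , true) ≈ 0#
    cleared⁺ = trans (∙-congˡ (ψ-edge C a zero)) (inverseʳ _)
    cleared : ∀ b → φ' (x , b) ≈ 0#
    cleared true  = cleared⁺
    cleared false = trans (+-isGain g (ψ-isGain C a) (x , true)) (trans (⁻¹-cong cleared⁺) ε⁻¹≈ε)
    unchanged : ∀ y b → T y ≡ false → y ≢ x → φ' (y , b) ≈ φ (y , b)
    unchanged y b y∉T y≢x = trans (∙-congˡ (ψ-absent C a y b off-C)) (identityʳ _)
      where
      off-C : ∀ i → proj₁ (Cycle.edge C i) ≢ y
      off-C zero    = y≢x ∘ ≡.sym
      off-C (suc i) = member-≢ y∉T (fundamental-cycle-in-T maximal x x∉T i)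

  normalize-on : MaximalForest G T → (L : List (Fin nE)) → ∀ {φ} → IsGain G Γ φ →
    Σ (EFun G Γ) λ φ' → IsGain G Γ φ' × ShiftEquiv G Γ φ φ' ×
      (∀ y → y ∈ L → T y ≡ false → ∀ b → φ' (y , b) ≈ 0#)
  normalize-on maximal []      {φ} g = φ , g , Star.ε , λ _ ()
  normalize-on maximal (x ∷ L) g with normalize-on maximal L g | T x in x∈?T
  ... | φL , gL , sL , zL | true  = φL , gL , sL , zeros
    where
    zeros : ∀ y → y ∈ x ∷ L → T y ≡ false → ∀ b → φL (y , b) ≈ 0#
    zeros y (here ≡.refl) y∉T with () ← ≡.trans (≡.sym x∈?T) y∉T
    zeros y (there y∈L)   y∉T = zL y y∈L y∉T
  ... | φL , gL , sL , zL | false with clear-edge maximal x x∈?T gL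
  ...   | φ' , g' , s' , cleared , unchanged = φ' , g' , sL Star.◅◅ s' , zeros
    where
    zeros : ∀ y → y ∈ x ∷ L → T y ≡ false → ∀ b → φ' (y , b) ≈ 0#
    zeros y (here ≡.refl) _ = cleared
    zeros y (there y∈L) y∉T b with y Fin.≟ x
    ... | yes ≡.refl = cleared b
    ... | no y≢x     = trans (unchanged y b y∉T y≢x) (zL y y∈L y∉T b)

  normalize : MaximalForest G T → ∀ {φ} → IsGain G Γ φ →
    Σ (EFun G Γ) λ φT → IsGain G Γ φT × Normalized G Γ T φT × ShiftEquiv G Γ φ φT
  normalize maximal g with normalize-on maximal (allFin nE) g
  ... | φT , gT , sT , zT = φT , gT , (λ x b x∉T → zT x (∈-allFin x) x∉T b) , sT

proposition4p4 : ∀ {c ℓ : Level} (Γ : AbelianGroup c ℓ) (G : Graph)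
    (φ : EFun G Γ) → IsGain G Γ φ →
    (T : EdgeSet G) → MaximalForest G T →
    Σ (EFun G Γ) λ φT →
      (IsGain G Γ φT × Normalized G Γ T φT × ShiftEquiv G Γ φ φT)
      × (∀ ψ' → IsGain G Γ ψ' → Normalized G Γ T ψ' → ShiftEquiv G Γ φ ψ' → _≈ᶠ_ G Γ ψ' φT)
proposition4p4 Γ G φ g T maximal =
  let open Normalization Γ G T
      (φT , gT , nT , sT) = normalize maximal g
  in φT , (gT , nT , sT) , λ ψ' g' n' s' → normalized-unique (proj₁ maximal) g' gT n' nT s' sT
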